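{- Let $F$ be a Ferrers diagram, let $k$ be the number of elements of $F$ in the first row (i.e. with $y=1$) and $\ell$ the number of elements of $F$ in the second row (with $y=2$). Then the divisor $D_{k+1,1}=\sum_{(x',y')\in F,\ x'\ne k+1,\ y'\ne 1}(x',y')$ on $R(F)$ has positive rank if and only if $(\ell,k-\ell+1)\in F$.
   Context: $\mathbb{N}=\{1,2,3,\dots\}$. A Ferrers diagram is a finite set $F\subset\mathbb{N}^2$ such that if $(x,y)\in F$ then ($x=1$ or $(x-1,y)\in F$) and ($y=1$ or $(x,y-1)\in F$). Here $x$ indexes the column and $y$ the row. The Ferrers rook graph $R(F)$ is the simple graph with vertex set $F$ in which distinct $(x,y),(x',y')$ are adjacent iff $x=x'$ or $y=y'$. Chip firing: firing a vertex sends one chip along each incident edge to each neighbor; equivalence of divisors is generated by firings. An effective divisor $D$ has positive rank if for every vertex $v$ there is an effective divisor equivalent to $D$ with a positive number of chips at $v$. -}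

module Defs where

open import Data.Nat as ℕ using (ℕ; zero; suc; _∸_; _+_)
open import Data.Integer as ℤ using (ℤ; +_; _-_; _<_; _≤_)
open import Data.Fin as Fin using (Fin)
open import Data.List using (List; length; filter; lookup; allFin; [])
open import Data.List.Membership.Propositional using (_∈_)
open import Data.List.Relation.Unary.All using (All)
open import Data.List.Relation.Unary.Unique.Propositional using (Unique)
open import Data.Product using (_×_; _,_; proj₁; proj₂; ∃)
open import Data.Sum using (_⊎_)
open import Relation.Binary.PropositionalEquality using (_≡_; _≢_)
open import Relation.Nullary using (Dec; yes; no; ¬_)
open import Relation.Nullary.Decidable using (_×-dec_; _⊎-dec_; ¬?)
open import Relation.Binary.Construct.Closure.Equivalence using (EqClosure)

-- A cell (x , y) : x = column, y = row.  ℕ here includes 0, but cells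
-- of a Ferrers diagram are required to have coordinates ≥ 1.
Cell : Set
Cell = ℕ × ℕ

record Ferrers : Set where
  field
    cells    : List Cell
    distinct : Unique cells
    positive : All (λ c → 1 ℕ.≤ proj₁ c × 1 ℕ.≤ proj₂ c) cells
    closedX  : ∀ {x y} → (x , y) ∈ cells → x ≡ 1 ⊎ (x ∸ 1 , y) ∈ cells
    closedY  : ∀ {x y} → (x , y) ∈ cells → y ≡ 1 ⊎ (x , y ∸ 1) ∈ cells

open Ferrers public

_∈F_ : Cell → Ferrers → Set
c ∈F F = c ∈ cells F

rowSize : Ferrers → ℕ → ℕ
rowSize F r = length (filter (λ c → proj₂ c ℕ.≟ r) (cells F))

Vertex : Ferrers → Set
Vertex F = Fin (length (cells F))

cell : (F : Ferrers) → Vertex F → Cell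
cell F v = lookup (cells F) v

Adjacent : (F : Ferrers) → Vertex F → Vertex F → Set
Adjacent F v w = v ≢ w × (proj₁ (cell F v) ≡ proj₁ (cell F w) ⊎ proj₂ (cell F v) ≡ proj₂ (cell F w))

adjacent? : (F : Ferrers) → (v w : Vertex F) → Dec (Adjacent F v w)
adjacent? F v w = ¬? (v Fin.≟ w) ×-dec
  ((proj₁ (cell F v) ℕ.≟ proj₁ (cell F w)) ⊎-dec (proj₂ (cell F v) ℕ.≟ proj₂ (cell F w)))

degree : (F : Ferrers) → Vertex F → ℕ
degree F v = length (filter (adjacent? F v) (allFin _))

Divisor : Ferrers → Set
Divisor F = Vertex F → ℤ

Effective : (F : Ferrers) → Divisor F → Set
Effective F D = ∀ v → + 0 ≤ D v

fire : (F : Ferrers) → Vertex F → Divisor F → Divisor F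
fire F v D w with v Fin.≟ w | adjacent? F v w
... | yes _ | _     = D w - + degree F v
... | no _  | yes _ = D w ℤ.+ + 1
... | no _  | no _  = D w

FiringStep : (F : Ferrers) → Divisor F → Divisor F → Set
FiringStep F D D' = ∃ λ v → ∀ w → D' w ≡ fire F v D w

Equiv : (F : Ferrers) → Divisor F → Divisor F → Set
Equiv F = EqClosure (FiringStep F)

PositiveRank : (F : Ferrers) → Divisor F → Set
PositiveRank F D = ∀ v → ∃ λ E → Effective F E × Equiv F D E × + 0 < E v

Dab : (F : Ferrers) → ℕ → ℕ → Divisor F
Dab F a b v with proj₁ (cell F v) ℕ.≟ a | proj₂ (cell F v) ℕ.≟ b
... | no _ | no _ = + 1
... | _    | _    = + 0

{-# OPTIONS --safe #-}
-- Let k and ℓ be the lengths of the first two rows and c = k ∸ ℓ. Column k + 1 is empty, so D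
-- is one chip on every cell above the first row. Firing all these cells gives D₁, which is zero
-- above the first row and has colSize x ∸ 1 chips on (x , 1); so it is positive at every cell
-- of the first row except those right of column ℓ. If (ℓ , c + 1) ∈ F, firing in addition the
-- first ℓ columns sends a chip to each of those, and costs every first-row cell of a column
-- x ≤ ℓ exactly c chips, which it has since that column is higher than c.
-- If (ℓ , c + 1) ∉ F then ℓ < k, D₁ has no chip on q = (k , 1), and D₁ is q-reduced by a
-- burning argument. A divisor equivalent to D₁ is D₁ - Δ h for some h, and the maximisers of h
-- would form a set avoiding q that can fire on D₁; so no effective divisor equivalent to D has a
-- chip on q.
module Submission where

open import Defs
open import Data.Nat using (ℕ; suc; _∸_; _+_)
open import Data.Product using (_,_)
open import Data.List using ([])
open import Relation.Binary.PropositionalEquality using (_≢_)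
open import Function.Bundles using (_⇔_)

open import Level using (0ℓ)
open import Function using (_∘_)
open import Function.Bundles using (mk⇔)
open import Data.Bool using (if_then_else_)
open import Data.Empty using (⊥)
open import Data.Product as Product using (_×_; proj₁; proj₂; ∃; swap)
open import Data.Product.Properties using (≡-dec)
open import Data.Sum as Sum using (_⊎_; inj₁; inj₂)
open import Data.Nat as ℕ using (zero; z≤n; s≤s)
import Data.Nat.Properties as ℕ
open import Data.Integer as ℤ using (ℤ; +_; -_; _-_; _*_; _≤_; _<_; +≤+; +<+)
import Data.Integer.Properties as ℤ
open import Data.Integer.Tactic.RingSolver using (solve-∀)
open import Data.Fin as Fin using (Fin)
open import Data.List as List using (List; _∷_; length; filter; map; lookup; tabulate; applyUpTo)
import Data.List.Properties as List
import Data.List.Extrema ℤ.≤-totalOrder as Extrema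
open import Data.List.Membership.Propositional using (_∈_)
open import Data.List.Membership.Propositional.Properties
  using (∈-filter⁺; ∈-filter⁻; ∈-lookup; ∈-map⁺; ∈-map⁻; ∈-applyUpTo⁺; ∈-applyUpTo⁻; ∈-allFin)
open import Data.List.Membership.Propositional.Properties.WithK using (unique∧set⇒bag)
import Data.List.Membership.DecPropositional as DecMembership
import Data.List.Relation.Unary.All as All
import Data.List.Relation.Unary.All.Properties as All
import Data.List.Relation.Unary.Any as Any
import Data.List.Relation.Unary.Any.Properties as Any
open import Data.List.Relation.Unary.AllPairs using (_∷_)
open import Data.List.Relation.Unary.Unique.Propositional using (Unique)
import Data.List.Relation.Unary.Unique.Propositional.Properties as Unique
open import Data.List.Relation.Binary.BagAndSetEquality using (∼bag⇒↭)
open import Data.List.Relation.Binary.Permutation.Propositional.Properties using (↭-length)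
open import Relation.Binary using (DecidableEquality)
open import Relation.Binary.PropositionalEquality
  using (_≡_; refl; sym; trans; cong; cong₂; subst; subst₂; _≗_; module ≡-Reasoning)
open import Relation.Binary.Construct.Closure.ReflexiveTransitive using (ε; _◅_; _◅◅_)
open import Relation.Binary.Construct.Closure.Symmetric using (fwd; bwd)
import Relation.Binary.Construct.Closure.Equivalence as EqClosure
open import Relation.Nullary using (¬_; Dec; yes; no; does; contradiction; ¬?; _×-dec_)
open import Relation.Nullary.Decidable using (decidable-stable)
open import Relation.Unary using (Pred; Decidable; _⊆_)
open import Relation.Unary.Properties using (_∩?_; ∁?)
open import Algebra.Properties.CommutativeMonoid.Sum ℤ.+-0-commutativeMonoid
  using (sum; sum-syntax; ∑-distrib-+; sum-cong-≗; sum-replicate-zero)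

𝟙 : ∀ {A : Set} → Dec A → ℤ
𝟙 a? = if does a? then + 1 else + 0

𝟙-nonneg : ∀ {A : Set} (a? : Dec A) → + 0 ≤ 𝟙 a?
𝟙-nonneg (yes _) = +≤+ z≤n
𝟙-nonneg (no _)  = +≤+ z≤n

𝟙-yes : ∀ {A : Set} (a? : Dec A) → A → 𝟙 a? ≡ + 1
𝟙-yes (yes _) _ = refl
𝟙-yes (no ¬a) a = contradiction a ¬a

𝟙-no : ∀ {A : Set} (a? : Dec A) → ¬ A → 𝟙 a? ≡ + 0
𝟙-no (yes a) ¬a = contradiction a ¬a
𝟙-no (no _)  _  = refl

𝟙-≟-sym : ∀ {n} (u v : Fin n) → 𝟙 (u Fin.≟ v) ≡ 𝟙 (v Fin.≟ u)
𝟙-≟-sym u v with u Fin.≟ v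
... | yes refl = sym (𝟙-yes (u Fin.≟ u) refl)
... | no u≢v   = sym (𝟙-no (v Fin.≟ u) (u≢v ∘ sym))

i-j≤i : ∀ i {j} → + 0 ≤ j → i - j ≤ i
i-j≤i i 0≤j = ℤ.≤-trans (ℤ.+-monoʳ-≤ i (ℤ.neg-mono-≤ 0≤j)) (ℤ.≤-reflexive (ℤ.+-identityʳ i))

i<j⇒1≤j-i : ∀ {i j} → i < j → + 1 ≤ j - i
i<j⇒1≤j-i {i} i<j =
  ℤ.i<j⇒suc[i]≤j (ℤ.≤-<-trans (ℤ.≤-reflexive (sym (ℤ.+-inverseʳ i))) (ℤ.+-monoˡ-< (- i) i<j))

sum-zero : ∀ {n} {f : Fin n → ℤ} → (∀ i → f i ≡ + 0) → sum f ≡ + 0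
sum-zero {n} f≡0 = trans (sum-cong-≗ f≡0) (sum-replicate-zero n)

sum-mono-≤ : ∀ {n} {f g : Fin n → ℤ} → (∀ i → f i ≤ g i) → sum f ≤ sum g
sum-mono-≤ {zero}  _   = ℤ.≤-refl
sum-mono-≤ {suc n} f≤g = ℤ.+-mono-≤ (f≤g Fin.zero) (sum-mono-≤ (f≤g ∘ Fin.suc))

sum-mono-< : ∀ {n} {f g : Fin n → ℤ} → (∀ i → f i ≤ g i) → ∀ j → f j < g j → sum f < sum g
sum-mono-< {suc n} f≤g Fin.zero    fj<gj =
  ℤ.+-mono-<-≤ fj<gj (sum-mono-≤ (f≤g ∘ Fin.suc))
sum-mono-< {suc n} f≤g (Fin.suc j) fj<gj =
  ℤ.+-mono-≤-< (f≤g Fin.zero) (sum-mono-< (f≤g ∘ Fin.suc) j fj<gj)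

sum-neg : ∀ {n} (f : Fin n → ℤ) → sum (λ i → - f i) ≡ - sum f
sum-neg {zero}  f = refl
sum-neg {suc n} f = trans (cong (λ s → - f Fin.zero ℤ.+ s) (sum-neg (f ∘ Fin.suc)))
                          (sym (ℤ.neg-distrib-+ (f Fin.zero) (sum (f ∘ Fin.suc))))

sum-δ : ∀ {n} (f : Fin n → ℤ) (v : Fin n) → ∑[ u < n ] (𝟙 (u Fin.≟ v) * f u) ≡ f v
sum-δ {suc n} f Fin.zero    =
  trans (cong₂ ℤ._+_ (ℤ.*-identityˡ (f Fin.zero)) (sum-zero (ℤ.*-zeroˡ ∘ f ∘ Fin.suc)))
        (ℤ.+-identityʳ (f Fin.zero))
sum-δ {suc n} f (Fin.suc v) = trans (ℤ.+-identityˡ _) (sum-δ (f ∘ Fin.suc) v)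

module _ {n : ℕ} where

  count : {P : Pred (Fin n) 0ℓ} → Decidable P → ℤ
  count P? = ∑[ u < n ] 𝟙 (P? u)

  module _ {P Q : Pred (Fin n) 0ℓ} (P? : Decidable P) (Q? : Decidable Q) where

    𝟙-mono : P ⊆ Q → ∀ u → 𝟙 (P? u) ≤ 𝟙 (Q? u)
    𝟙-mono P⊆Q u with P? u | Q? u
    ... | yes _  | yes _  = ℤ.≤-refl
    ... | yes pu | no ¬qu = contradiction (P⊆Q pu) ¬qu
    ... | no _   | q?     = 𝟙-nonneg q?

    count-mono : P ⊆ Q → count P? ≤ count Q?
    count-mono P⊆Q = sum-mono-≤ (𝟙-mono P⊆Q)

    count-mono-< : P ⊆ Q → ∀ {v} → Q v → ¬ P v → count P? < count Q?
    count-mono-< P⊆Q {v} qv ¬pv = sum-mono-< (𝟙-mono P⊆Q) v 𝟙-<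
      where
      𝟙-< : 𝟙 (P? v) < 𝟙 (Q? v)
      𝟙-< with P? v | Q? v
      ... | yes pv | _      = contradiction pv ¬pv
      ... | no _   | yes _  = +<+ (s≤s z≤n)
      ... | no _   | no ¬qv = contradiction qv ¬qv

  count-nonneg : {P : Pred (Fin n) 0ℓ} (P? : Decidable P) → + 0 ≤ count P?
  count-nonneg P? = ℤ.≤-trans (ℤ.≤-reflexive (sym (sum-replicate-zero n))) (sum-mono-≤ (𝟙-nonneg ∘ P?))

  count-positive : {P : Pred (Fin n) 0ℓ} (P? : Decidable P) → ∀ {v} → P v → + 0 < count P?
  count-positive P? {v} pv = begin-strict
    + 0                  ≡⟨ sym (sum-replicate-zero n) ⟩
    sum {n} (λ _ → + 0)  <⟨ sum-mono-< (𝟙-nonneg ∘ P?) v 0<𝟙 ⟩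
    count P?             ∎
    where
    open ℤ.≤-Reasoning
    0<𝟙 : + 0 < 𝟙 (P? v)
    0<𝟙 = subst (+ 0 <_) (sym (𝟙-yes (P? v) pv)) (+<+ (s≤s z≤n))

  count-none : {P : Pred (Fin n) 0ℓ} (P? : Decidable P) → (∀ u → ¬ P u) → count P? ≡ + 0
  count-none P? ∅ = sum-zero (λ u → 𝟙-no (P? u) (∅ u))

  count-≡ : ∀ v → count (Fin._≟ v) ≡ + 1
  count-≡ v = trans (sum-cong-≗ (λ u → sym (ℤ.*-identityʳ (𝟙 (u Fin.≟ v))))) (sum-δ (λ _ → + 1) v)

  count-cong : {P Q : Pred (Fin n) 0ℓ} (P? : Decidable P) (Q? : Decidable Q) →
               P ⊆ Q → Q ⊆ P → count P? ≡ count Q?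
  count-cong P? Q? P⊆Q Q⊆P = ℤ.≤-antisym (count-mono P? Q? P⊆Q) (count-mono Q? P? Q⊆P)

module _ {A : Set} where

  unique-⊆⇒length-≤ : DecidableEquality A → {xs ys : List A} → Unique xs → Unique ys →
                       (∀ {x} → x ∈ xs → x ∈ ys) → length xs ℕ.≤ length ys
  unique-⊆⇒length-≤ _≟_ {xs} {ys} !xs !ys xs⊆ys = begin
    length xs               ≡⟨ ↭-length (∼bag⇒↭ (unique∧set⇒bag !xs (Unique.filter⁺ ∈xs? !ys) xs∼xs∩ys)) ⟩
    length (filter ∈xs? ys) ≤⟨ List.length-filter ∈xs? ys ⟩
    length ys               ∎
    where
    open ℕ.≤-Reasoning
    ∈xs? : Decidable (_∈ xs)
    ∈xs? x = DecMembership._∈?_ _≟_ x xs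
    xs∼xs∩ys : ∀ {x} → x ∈ xs ⇔ x ∈ filter ∈xs? ys
    xs∼xs∩ys = mk⇔ (λ x∈xs → ∈-filter⁺ ∈xs? (xs⊆ys x∈xs) x∈xs) (proj₂ ∘ ∈-filter⁻ ∈xs? {xs = ys})

  lookup-injective : {xs : List A} → Unique xs → ∀ i j → lookup xs i ≡ lookup xs j → i ≡ j
  lookup-injective {_ ∷ _} _         Fin.zero    Fin.zero    _  = refl
  lookup-injective {_ ∷ _} (x∉ ∷ _)  Fin.zero    (Fin.suc j) eq = contradiction eq (All.lookup x∉ (∈-lookup j))
  lookup-injective {_ ∷ _} (x∉ ∷ _)  (Fin.suc i) Fin.zero    eq = contradiction (sym eq) (All.lookup x∉ (∈-lookup i))
  lookup-injective {_ ∷ _} (_ ∷ !xs) (Fin.suc i) (Fin.suc j) eq = cong Fin.suc (lookup-injective !xs i j eq)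

  module _ {P : Pred A 0ℓ} (P? : Decidable P) where

    count-tabulate : ∀ {n} (f : Fin n → A) → count (P? ∘ f) ≡ + length (filter P? (tabulate f))
    count-tabulate {zero}  f = refl
    count-tabulate {suc n} f with P? (f Fin.zero)
    ... | yes _ = cong (λ s → + 1 ℤ.+ s) (count-tabulate (f ∘ Fin.suc))
    ... | no _  = trans (ℤ.+-identityˡ _) (count-tabulate (f ∘ Fin.suc))

    count-lookup : (xs : List A) → count (P? ∘ lookup xs) ≡ + length (filter P? xs)
    count-lookup xs = trans (count-tabulate (lookup xs))
                            (cong (λ ys → + length (filter P? ys)) (List.tabulate-lookup xs))

    length-filter-map : ∀ {B : Set} (f : B → A) xs →
                        length (filter P? (map f xs)) ≡ length (filter (P? ∘ f) xs)
    length-filter-map f List.[] = refl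
    length-filter-map f (x ∷ xs) with P? (f x)
    ... | yes _ = cong suc (length-filter-map f xs)
    ... | no _  = length-filter-map f xs

module Laplacian {n : ℕ} {_∼_ : Fin n → Fin n → Set} (_∼?_ : ∀ v w → Dec (v ∼ w)) where

  Δ : (Fin n → ℤ) → Fin n → ℤ
  Δ h w = ∑[ u < n ] (𝟙 (w ∼? u) * (h w - h u))

  Δ-cong : ∀ {h g} → h ≗ g → Δ h ≗ Δ g
  Δ-cong h≗g w = sum-cong-≗ (λ u → cong₂ (λ a b → 𝟙 (w ∼? u) * (a - b)) (h≗g w) (h≗g u))

  Δ-+ : ∀ h g w → Δ (λ u → h u ℤ.+ g u) w ≡ Δ h w ℤ.+ Δ g w
  Δ-+ h g w = trans (sum-cong-≗ (λ u → distrib (𝟙 (w ∼? u)) (h w) (g w) (h u) (g u)))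
                    (∑-distrib-+ (λ u → 𝟙 (w ∼? u) * (h w - h u)) (λ u → 𝟙 (w ∼? u) * (g w - g u)))
    where
    distrib : ∀ a x y z t → a * ((x ℤ.+ y) - (z ℤ.+ t)) ≡ a * (x - z) ℤ.+ a * (y - t)
    distrib = solve-∀

  Δ-neg : ∀ h w → Δ (λ u → - h u) w ≡ - Δ h w
  Δ-neg h w = trans (sum-cong-≗ (λ u → distrib (𝟙 (w ∼? u)) (h w) (h u)))
                    (sum-neg (λ u → 𝟙 (w ∼? u) * (h w - h u)))
    where
    distrib : ∀ a x y → a * (- x - - y) ≡ - (a * (x - y))
    distrib = solve-∀

  Δ-zero : ∀ w → Δ (λ _ → + 0) w ≡ + 0
  Δ-zero w = sum-zero (λ u → ℤ.*-zeroʳ (𝟙 (w ∼? u)))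

  deg[_]_ : {P : Pred (Fin n) 0ℓ} → Decidable P → Fin n → ℤ
  deg[ P? ] w = count ((w ∼?_) ∩? P?)

  module _ {S : Pred (Fin n) 0ℓ} (S? : Decidable S) where

    Δ-𝟙-∈ : ∀ {w} → S w → Δ (𝟙 ∘ S?) w ≡ deg[ ∁? S? ] w
    Δ-𝟙-∈ {w} w∈S = sum-cong-≗ term
      where
      term : ∀ u → 𝟙 (w ∼? u) * (𝟙 (S? w) - 𝟙 (S? u)) ≡ 𝟙 ((w ∼? u) ×-dec ¬? (S? u))
      term u with S? w | w ∼? u | S? u
      ... | no w∉S | _     | _     = contradiction w∈S w∉S
      ... | yes _  | yes _ | yes _ = refl
      ... | yes _  | yes _ | no _  = refl
      ... | yes _  | no _  | _     = refl

    Δ-𝟙-∉ : ∀ {w} → ¬ S w → Δ (𝟙 ∘ S?) w ≡ - deg[ S? ] w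
    Δ-𝟙-∉ {w} w∉S = trans (sum-cong-≗ term) (sum-neg (λ u → 𝟙 ((w ∼? u) ×-dec S? u)))
      where
      term : ∀ u → 𝟙 (w ∼? u) * (𝟙 (S? w) - 𝟙 (S? u)) ≡ - 𝟙 ((w ∼? u) ×-dec S? u)
      term u with S? w | w ∼? u | S? u
      ... | yes w∈S | _     | _     = contradiction w∈S w∉S
      ... | no _    | yes _ | yes _ = refl
      ... | no _    | yes _ | no _  = refl
      ... | no _    | no _  | _     = refl

    CanFire : (Fin n → ℤ) → Set
    CanFire D = ∀ {w} → S w → deg[ ∁? S? ] w ≤ D w

  module _ (h : Fin n → ℤ) {M : ℤ} (h≤M : ∀ u → h u ≤ M) where

    deg-below-max≤Δ : ∀ {w} → M ≤ h w → deg[ ∁? (λ u → M ℤ.≤? h u) ] w ≤ Δ h w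
    deg-below-max≤Δ {w} M≤hw = sum-mono-≤ term
      where
      term : ∀ u → 𝟙 ((w ∼? u) ×-dec ¬? (M ℤ.≤? h u)) ≤ 𝟙 (w ∼? u) * (h w - h u)
      term u with w ∼? u | M ℤ.≤? h u
      ... | no _  | _      = ℤ.≤-refl
      ... | yes _ | yes _  = ℤ.≤-trans (ℤ.i≤j⇒0≤j-i (ℤ.≤-trans (h≤M u) M≤hw))
                                       (ℤ.≤-reflexive (sym (ℤ.*-identityˡ _)))
      ... | yes _ | no M≰hu = ℤ.≤-trans (i<j⇒1≤j-i (ℤ.<-≤-trans (ℤ.≰⇒> M≰hu) M≤hw))
                                        (ℤ.≤-reflexive (sym (ℤ.*-identityˡ _)))

  -- q-reducedness in Dhar's sense, without the usual requirement D ≥ 0 away from q.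
  Reduced : (Fin n → ℤ) → Fin n → Set₁
  Reduced D q = ∀ {S : Pred (Fin n) 0ℓ} (S? : Decidable S) → ¬ S q → CanFire S? D → ∀ w → ¬ S w

  reduced⇒nonpositive : ∀ {D E h : Fin n → ℤ} {q} → Reduced D q → D q ≤ + 0 →
                        (∀ w → + 0 ≤ E w) → (∀ w → E w ≡ D w - Δ h w) → E q ≤ + 0
  -- The maximisers of h can fire on D, so q is one of them.
  reduced⇒nonpositive {D} {E} {h} {q} reduced Dq≤0 E≥0 E≡D-Δh = bound (M ℤ.≤? h q)
    where
    m : Fin n
    m = Extrema.argmax h q (List.allFin n)
    M : ℤ
    M = h m
    h≤M : ∀ u → h u ≤ M
    h≤M u = All.lookup (Extrema.f[xs]≤f[argmax] {f = h} q (List.allFin n)) (∈-allFin u)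
    Δh≤D : ∀ w → Δ h w ≤ D w
    Δh≤D w = ℤ.≤-trans (ℤ.≤-reflexive (solve-Δ (D w) (Δ h w)))
                       (i-j≤i (D w) (ℤ.≤-trans (E≥0 w) (ℤ.≤-reflexive (E≡D-Δh w))))
      where
      solve-Δ : ∀ d x → x ≡ d - (d - x)
      solve-Δ = solve-∀
    maximiser? : Decidable (λ u → M ≤ h u)
    maximiser? u = M ℤ.≤? h u
    maximisers-fire : CanFire maximiser? D
    maximisers-fire {w} M≤hw = ℤ.≤-trans (deg-below-max≤Δ h h≤M M≤hw) (Δh≤D w)
    bound : Dec (M ≤ h q) → E q ≤ + 0
    bound (no M≰hq)  = contradiction ℤ.≤-refl (reduced maximiser? M≰hq maximisers-fire m)
    bound (yes M≤hq) = begin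
      E q          ≡⟨ E≡D-Δh q ⟩
      D q - Δ h q  ≤⟨ i-j≤i (D q) (ℤ.≤-trans (count-nonneg ((q ∼?_) ∩? ∁? maximiser?))
                                            (deg-below-max≤Δ h h≤M M≤hq)) ⟩
      D q          ≤⟨ Dq≤0 ⟩
      + 0          ∎
      where open ℤ.≤-Reasoning

nonempty-member : ∀ {A : Set} {xs : List A} → xs ≢ [] → ∃ (_∈ xs)
nonempty-member {xs = List.[]}  []≢[] = contradiction refl []≢[]
nonempty-member {xs = x ∷ _}    _     = x , Any.here refl

∈F-positive : ∀ F {x y} → (x , y) ∈F F → 1 ℕ.≤ x × 1 ℕ.≤ y
∈F-positive F = All.lookup (positive F)

∈F-left : ∀ F {x x′ y} → (x , y) ∈F F → 1 ℕ.≤ x′ → x′ ℕ.≤ x → (x′ , y) ∈F F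
∈F-left F {zero}       _ 1≤x′ x′≤0 = contradiction (ℕ.≤-trans 1≤x′ x′≤0) λ ()
∈F-left F {suc x} {x′} p 1≤x′ x′≤1+x with x′ ℕ.≟ suc x | closedX F p
... | yes refl  | _         = p
... | no x′≢1+x | inj₁ refl = contradiction (ℕ.≤-antisym x′≤1+x 1≤x′) x′≢1+x
... | no x′≢1+x | inj₂ q    = ∈F-left F q 1≤x′ (ℕ.s≤s⁻¹ (ℕ.≤∧≢⇒< x′≤1+x x′≢1+x))

∈-map-swap⁻ : ∀ {x y} {cs : List Cell} → (x , y) ∈ map swap cs → (y , x) ∈ cs
∈-map-swap⁻ p with c , c∈cs , refl ← ∈-map⁻ swap p = c∈cs

transpose : Ferrers → Ferrers
transpose F = record
  { cells    = map swap (cells F)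
  ; distinct = Unique.map⁺ (cong swap) (distinct F)
  ; positive = All.map⁺ (All.map Product.swap (positive F))
  ; closedX  = Sum.map₂ (∈-map⁺ swap) ∘ closedY F ∘ ∈-map-swap⁻
  ; closedY  = Sum.map₂ (∈-map⁺ swap) ∘ closedX F ∘ ∈-map-swap⁻
  }

∈F-transpose : ∀ F {x y} → (x , y) ∈F F → (y , x) ∈F transpose F
∈F-transpose F = ∈-map⁺ swap

∈F-down : ∀ F {x y y′} → (x , y) ∈F F → 1 ℕ.≤ y′ → y′ ℕ.≤ y → (x , y′) ∈F F
∈F-down F p 1≤y′ y′≤y = ∈-map-swap⁻ (∈F-left (transpose F) (∈F-transpose F p) 1≤y′ y′≤y)

origin∈F : ∀ F {c} → c ∈F F → (1 , 1) ∈F F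
origin∈F F {x , y} p = ∈F-left F (∈F-down F p (s≤s z≤n) 1≤y) (s≤s z≤n) 1≤x
  where
  1≤x : 1 ℕ.≤ x
  1≤x = proj₁ (∈F-positive F p)
  1≤y : 1 ℕ.≤ y
  1≤y = proj₂ (∈F-positive F p)

_≟ᶜ_ : DecidableEquality Cell
_≟ᶜ_ = ≡-dec ℕ._≟_ ℕ._≟_

segment : ℕ → ℕ → ℕ → List Cell
segment r a b = applyUpTo (λ i → (i + suc a , r)) (b ∸ a)

length-segment : ∀ r a b → length (segment r a b) ≡ b ∸ a
length-segment r a b = List.length-applyUpTo _ (b ∸ a)

segment-unique : ∀ r a b → Unique (segment r a b)
segment-unique r a b = Unique.applyUpTo⁺₁ _ (b ∸ a) λ i<j _ eq →
  ℕ.<⇒≢ i<j (ℕ.+-cancelʳ-≡ (suc a) _ _ (cong proj₁ eq))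

∈-segment⁻ : ∀ {r a b x y} → (x , y) ∈ segment r a b → y ≡ r × a ℕ.< x × x ℕ.≤ b
∈-segment⁻ {r} {a} {b} p with i , i<b∸a , refl ← ∈-applyUpTo⁻ (λ i → (i + suc a , r)) p =
  refl , ℕ.m≤n+m (suc a) i , x≤b
  where
  a≤b : a ℕ.≤ b
  a≤b = ℕ.<⇒≤ (ℕ.m∸n≢0⇒n<m λ b∸a≡0 → ℕ.n≮0 (subst (i ℕ.<_) b∸a≡0 i<b∸a))
  x≤b : i + suc a ℕ.≤ b
  x≤b = ℕ.≤-trans (ℕ.≤-reflexive (ℕ.+-suc i a)) (ℕ.m≤o∸n⇒m+n≤o (suc i) a≤b i<b∸a)

∈-segment⁺ : ∀ {r a b x} → a ℕ.< x → x ℕ.≤ b → (x , r) ∈ segment r a b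
∈-segment⁺ {r} {a} {b} {x} a<x x≤b = subst (_∈ segment r a b) (cong (_, r) (ℕ.m∸n+n≡m a<x))
  (∈-applyUpTo⁺ (λ i → (i + suc a , r)) (ℕ.m+n≤o⇒m≤o∸n (suc (x ∸ suc a)) x+1≤b))
  where
  x+1≤b : suc (x ∸ suc a) + a ℕ.≤ b
  x+1≤b = ℕ.≤-trans (ℕ.≤-reflexive (trans (sym (ℕ.+-suc (x ∸ suc a) a)) (ℕ.m∸n+n≡m a<x))) x≤b

inRow? : ∀ r → Decidable (λ (c : Cell) → proj₂ c ≡ r)
inRow? r c = proj₂ c ℕ.≟ r

rowCells : Ferrers → ℕ → List Cell
rowCells F r = filter (inRow? r) (cells F)

rowCells-unique : ∀ F r → Unique (rowCells F r)
rowCells-unique F r = Unique.filter⁺ (inRow? r) (distinct F)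

∈F⇒≤rowSize : ∀ F {x r} → (x , r) ∈F F → x ℕ.≤ rowSize F r
∈F⇒≤rowSize F {x} {r} p = subst (ℕ._≤ rowSize F r) (length-segment r 0 x)
  (unique-⊆⇒length-≤ _≟ᶜ_ (segment-unique r 0 x) (rowCells-unique F r) segment⊆row)
  where
  segment⊆row : ∀ {c} → c ∈ segment r 0 x → c ∈ rowCells F r
  segment⊆row q with refl , 0<x′ , x′≤x ← ∈-segment⁻ q =
    ∈-filter⁺ (inRow? r) (∈F-left F p 0<x′ x′≤x) refl

≤rowSize⇒∈F : ∀ F {x r} → 1 ℕ.≤ x → x ℕ.≤ rowSize F r → (x , r) ∈F F
≤rowSize⇒∈F F {suc x} {r} _ x<rowSize with DecMembership._∈?_ _≟ᶜ_ (suc x , r) (cells F)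
... | yes p   = p
... | no x∉F = contradiction (ℕ.≤-trans x<rowSize rowSize≤x) (ℕ.n≮n x)
  where
  row⊆segment : ∀ {c} → c ∈ rowCells F r → c ∈ segment r 0 x
  row⊆segment q with c∈F , refl ← ∈-filter⁻ (inRow? r) q =
    ∈-segment⁺ (proj₁ (∈F-positive F c∈F))
               (ℕ.s≤s⁻¹ (ℕ.≰⇒> λ x<x′ → x∉F (∈F-left F c∈F (s≤s z≤n) x<x′)))
  rowSize≤x : rowSize F r ℕ.≤ x
  rowSize≤x = subst (rowSize F r ℕ.≤_) (length-segment r 0 x)
    (unique-⊆⇒length-≤ _≟ᶜ_ (rowCells-unique F r) (segment-unique r 0 x) row⊆segment)

RowBeyond : ℕ → ℕ → Pred Cell 0ℓ
RowBeyond r m c = proj₂ c ≡ r × m ℕ.< proj₁ c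

rowBeyond? : ∀ r m → Decidable (RowBeyond r m)
rowBeyond? r m c = inRow? r c ×-dec (m ℕ.<? proj₁ c)

length-rowBeyond : ∀ F r m → length (filter (rowBeyond? r m) (cells F)) ≡ rowSize F r ∸ m
length-rowBeyond F r m = ℕ.≤-antisym
  (subst (length beyond ℕ.≤_) (length-segment r m R)
         (unique-⊆⇒length-≤ _≟ᶜ_ beyond-unique (segment-unique r m R) beyond⊆segment))
  (subst (ℕ._≤ length beyond) (length-segment r m R)
         (unique-⊆⇒length-≤ _≟ᶜ_ (segment-unique r m R) beyond-unique segment⊆beyond))
  where
  R : ℕ
  R = rowSize F r
  beyond : List Cell
  beyond = filter (rowBeyond? r m) (cells F)
  beyond-unique : Unique beyond
  beyond-unique = Unique.filter⁺ (rowBeyond? r m) (distinct F)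
  beyond⊆segment : ∀ {c} → c ∈ beyond → c ∈ segment r m R
  beyond⊆segment q with c∈F , refl , m<x ← ∈-filter⁻ (rowBeyond? r m) q =
    ∈-segment⁺ m<x (∈F⇒≤rowSize F c∈F)
  segment⊆beyond : ∀ {c} → c ∈ segment r m R → c ∈ beyond
  segment⊆beyond q with refl , m<x , x≤R ← ∈-segment⁻ q =
    ∈-filter⁺ (rowBeyond? r m) (≤rowSize⇒∈F F (ℕ.≤-trans (s≤s z≤n) m<x) x≤R) (refl , m<x)

rowSize-antitone : ∀ F {r} → 1 ℕ.≤ r → rowSize F (suc r) ℕ.≤ rowSize F r
rowSize-antitone F {r} 1≤r with rowSize F (suc r) in eq
... | zero  = z≤n
... | suc m = ∈F⇒≤rowSize F
  (∈F-down F (≤rowSize⇒∈F F (s≤s z≤n) (ℕ.≤-reflexive (sym eq))) 1≤r (ℕ.n≤1+n r))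

colSize : Ferrers → ℕ → ℕ
colSize F = rowSize (transpose F)

length-columnBeyond : ∀ F x m → length (filter (rowBeyond? x m ∘ swap) (cells F)) ≡ colSize F x ∸ m
length-columnBeyond F x m =
  trans (sym (length-filter-map (rowBeyond? x m) swap (cells F))) (length-rowBeyond (transpose F) x m)

∈F⇒≤colSize : ∀ F {x y} → (x , y) ∈F F → y ℕ.≤ colSize F x
∈F⇒≤colSize F p = ∈F⇒≤rowSize (transpose F) (∈F-transpose F p)

≤colSize⇒∈F : ∀ F {x y} → 1 ℕ.≤ y → y ℕ.≤ colSize F x → (x , y) ∈F F
≤colSize⇒∈F F 1≤y y≤colSize = ∈-map-swap⁻ (≤rowSize⇒∈F (transpose F) 1≤y y≤colSize)

module RookGraph (F : Ferrers) where

  open Laplacian (adjacent? F) public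

  private
    n : ℕ
    n = length (cells F)

  X Y : Vertex F → ℕ
  X u = proj₁ (cell F u)
  Y u = proj₂ (cell F u)

  cell-injective : ∀ {u w} → cell F u ≡ cell F w → u ≡ w
  cell-injective = lookup-injective (distinct F) _ _

  cell∈F : ∀ u → cell F u ∈F F
  cell∈F = ∈-lookup

  vertexAt : ∀ {c} → c ∈F F → ∃ λ u → cell F u ≡ c
  vertexAt p = Any.index p , sym (Any.lookup-index p)

  adjacent-sym : ∀ {v w} → Adjacent F v w → Adjacent F w v
  adjacent-sym (v≢w , shared) = v≢w ∘ sym , Sum.map sym sym shared

  δ : Vertex F → Vertex F → ℤ
  δ v u = 𝟙 (u Fin.≟ v)

  Δδ-self : ∀ v → Δ (δ v) v ≡ + degree F v
  Δδ-self v = trans (sum-cong-≗ term) (count-tabulate (adjacent? F v) (λ u → u))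
    where
    term : ∀ u → 𝟙 (adjacent? F v u) * (δ v v - δ v u) ≡ 𝟙 (adjacent? F v u)
    term u = trans (cong (λ z → 𝟙 (adjacent? F v u) * (z - δ v u)) (𝟙-yes (v Fin.≟ v) refl))
                   (𝟙-disjoint (adjacent? F v u) (u Fin.≟ v) λ (v≢u , _) → v≢u ∘ sym)
      where
      𝟙-disjoint : ∀ {A B : Set} (a? : Dec A) (b? : Dec B) → (A → ¬ B) → 𝟙 a? * (+ 1 - 𝟙 b?) ≡ 𝟙 a?
      𝟙-disjoint (yes a) (yes b) a⇒¬b = contradiction b (a⇒¬b a)
      𝟙-disjoint (yes _) (no _)  _    = refl
      𝟙-disjoint (no _)  _       _    = refl

  Δδ-other : ∀ {v w} → v ≢ w → Δ (δ v) w ≡ - 𝟙 (adjacent? F w v)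
  Δδ-other {v} {w} v≢w = begin
    Δ (δ v) w                                             ≡⟨ sum-cong-≗ term ⟩
    ∑[ u < n ] (- (δ v u * 𝟙 (adjacent? F w u)))  ≡⟨ sum-neg (λ u → δ v u * 𝟙 (adjacent? F w u)) ⟩
    - ∑[ u < n ] (δ v u * 𝟙 (adjacent? F w u))    ≡⟨ cong -_ (sum-δ (𝟙 ∘ adjacent? F w) v) ⟩
    - 𝟙 (adjacent? F w v)                                 ∎
    where
    open ≡-Reasoning
    negate : ∀ a d → a * (+ 0 - d) ≡ - (d * a)
    negate = solve-∀
    term : ∀ u → 𝟙 (adjacent? F w u) * (δ v w - δ v u) ≡ - (δ v u * 𝟙 (adjacent? F w u))
    term u = trans (cong (λ z → 𝟙 (adjacent? F w u) * (z - δ v u)) (𝟙-no (w Fin.≟ v) (v≢w ∘ sym)))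
                   (negate (𝟙 (adjacent? F w u)) (δ v u))

  fire-Δ : ∀ v D w → fire F v D w ≡ D w - Δ (δ v) w
  fire-Δ v D w with v Fin.≟ w | adjacent? F v w
  ... | yes refl | _       = cong (λ z → D v - z) (sym (Δδ-self v))
  ... | no v≢w   | yes adj = begin
    D w ℤ.+ + 1                  ≡⟨ cong (λ z → D w - - z) (sym (𝟙-yes (adjacent? F w v) (adjacent-sym adj))) ⟩
    D w - - 𝟙 (adjacent? F w v)  ≡⟨ cong (λ z → D w - z) (sym (Δδ-other v≢w)) ⟩
    D w - Δ (δ v) w              ∎
    where open ≡-Reasoning
  ... | no v≢w   | no ¬adj = begin
    D w                          ≡⟨ sym (ℤ.+-identityʳ (D w)) ⟩
    D w - - + 0                  ≡⟨ cong (λ z → D w - - z) (sym (𝟙-no (adjacent? F w v) (¬adj ∘ adjacent-sym))) ⟩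
    D w - - 𝟙 (adjacent? F w v)  ≡⟨ cong (λ z → D w - z) (sym (Δδ-other v≢w)) ⟩
    D w - Δ (δ v) w              ∎
    where open ≡-Reasoning

  equiv⇒Δ : ∀ {D E} → Equiv F D E → ∃ λ h → ∀ w → E w ≡ D w - Δ h w
  equiv⇒Δ {D} ε =
    (λ _ → + 0) , λ w → sym (trans (cong (λ z → D w - z) (Δ-zero w)) (ℤ.+-identityʳ (D w)))
  equiv⇒Δ {D} {E} (_◅_ {j = D′} (fwd (v , D′≡fire)) rest) with h , E≡ ← equiv⇒Δ rest =
    (λ u → δ v u ℤ.+ h u) , λ w → begin
      E w                              ≡⟨ E≡ w ⟩
      D′ w - Δ h w                     ≡⟨ cong (λ z → z - Δ h w) (trans (D′≡fire w) (fire-Δ v D w)) ⟩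
      D w - Δ (δ v) w - Δ h w          ≡⟨ regroup (D w) (Δ (δ v) w) (Δ h w) ⟩
      D w - (Δ (δ v) w ℤ.+ Δ h w)      ≡⟨ cong (λ z → D w - z) (sym (Δ-+ (δ v) h w)) ⟩
      D w - Δ (λ u → δ v u ℤ.+ h u) w  ∎
    where
    open ≡-Reasoning
    regroup : ∀ d a b → d - a - b ≡ d - (a ℤ.+ b)
    regroup = solve-∀
  equiv⇒Δ {D} {E} (_◅_ {j = D′} (bwd (v , D≡fire)) rest) with h , E≡ ← equiv⇒Δ rest =
    (λ u → - δ v u ℤ.+ h u) , λ w → begin
      E w                                    ≡⟨ E≡ w ⟩
      D′ w - Δ h w                           ≡⟨ cong (λ z → z - Δ h w) (D′≡ w) ⟩
      D w ℤ.+ Δ (δ v) w - Δ h w              ≡⟨ regroup (D w) (Δ (δ v) w) (Δ h w) ⟩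
      D w - (- Δ (δ v) w ℤ.+ Δ h w)          ≡⟨ cong (λ z → D w - (z ℤ.+ Δ h w)) (sym (Δ-neg (δ v) w)) ⟩
      D w - (Δ (λ u → - δ v u) w ℤ.+ Δ h w)  ≡⟨ cong (λ z → D w - z) (sym (Δ-+ (λ u → - δ v u) h w)) ⟩
      D w - Δ (λ u → - δ v u ℤ.+ h u) w      ∎
    where
    open ≡-Reasoning
    regroup : ∀ d a b → d ℤ.+ a - b ≡ d - (- a ℤ.+ b)
    regroup = solve-∀
    unfire : ∀ d a → d ≡ d - a ℤ.+ a
    unfire = solve-∀
    D′≡ : ∀ w → D′ w ≡ D w ℤ.+ Δ (δ v) w
    D′≡ w = trans (unfire (D′ w) (Δ (δ v) w))
                  (cong (λ z → z ℤ.+ Δ (δ v) w) (sym (trans (D≡fire w) (fire-Δ v D′ w))))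

  Realisable : (Vertex F → ℤ) → Set
  Realisable h = ∀ {D E} → (∀ w → E w ≡ D w - Δ h w) → Equiv F D E

  realisable-δ : ∀ v → Realisable (δ v)
  realisable-δ v {D} E≡ = fwd (v , λ w → trans (E≡ w) (sym (fire-Δ v D w))) ◅ ε

  realisable-cong : ∀ {h g} → h ≗ g → Realisable h → Realisable g
  realisable-cong h≗g realise-h {D} E≡ =
    realise-h λ w → trans (E≡ w) (cong (λ z → D w - z) (sym (Δ-cong h≗g w)))

  -- Divisors are compared as functions, so pointwise equal ones are linked by firing v and
  -- un-firing it.
  realisable-zero : Vertex F → Realisable (λ _ → + 0)
  realisable-zero v {D} {E} E≡ = fwd (v , λ _ → refl) ◅ bwd (v , refire) ◅ ε
    where
    E≗D : E ≗ D
    E≗D w = trans (E≡ w) (trans (cong (λ z → D w - z) (Δ-zero w)) (ℤ.+-identityʳ (D w)))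
    refire : ∀ w → fire F v D w ≡ fire F v E w
    refire w = trans (fire-Δ v D w) (trans (cong (λ z → z - Δ (δ v) w) (sym (E≗D w))) (sym (fire-Δ v E w)))

  realisable-+ : ∀ {h g} → Realisable h → Realisable g → Realisable (λ u → h u ℤ.+ g u)
  realisable-+ {h} {g} realise-h realise-g {D} {E} E≡ =
    realise-h {E = λ w → D w - Δ h w} (λ _ → refl) ◅◅ realise-g λ w → trans (E≡ w) (begin
      D w - Δ (λ u → h u ℤ.+ g u) w  ≡⟨ cong (λ z → D w - z) (Δ-+ h g w) ⟩
      D w - (Δ h w ℤ.+ Δ g w)        ≡⟨ regroup (D w) (Δ h w) (Δ g w) ⟩
      D w - Δ h w - Δ g w            ∎)
    where
    open ≡-Reasoning
    regroup : ∀ d a b → d - (a ℤ.+ b) ≡ d - a - b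
    regroup = solve-∀

  realisable-neg : ∀ {h} → Realisable h → Realisable (λ u → - h u)
  realisable-neg {h} realise-h {D} {E} E≡ = EqClosure.symmetric (FiringStep F) (realise-h λ w → begin
    D w                       ≡⟨ regroup (D w) (Δ h w) ⟩
    D w - - Δ h w - Δ h w     ≡⟨ cong (λ z → z - Δ h w) (sym (trans (E≡ w) (cong (λ z → D w - z) (Δ-neg h w)))) ⟩
    E w - Δ h w               ∎)
    where
    open ≡-Reasoning
    regroup : ∀ d a → d ≡ d - - a - a
    regroup = solve-∀

  realisable-ℕ-scaled-δ : Vertex F → ∀ m v → Realisable (λ u → + m * δ v u)
  realisable-ℕ-scaled-δ q zero    v = realisable-cong (λ u → sym (ℤ.*-zeroˡ (δ v u))) (realisable-zero q)
  realisable-ℕ-scaled-δ q (suc m) v = realisable-cong (λ u → sym (ℤ.suc-* (+ m) (δ v u)))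
    (realisable-+ {δ v} {λ u → + m * δ v u} (realisable-δ v) (realisable-ℕ-scaled-δ q m v))

  realisable-scaled-δ : Vertex F → ∀ c v → Realisable (λ u → c * δ v u)
  realisable-scaled-δ q (+ m)        v = realisable-ℕ-scaled-δ q m v
  realisable-scaled-δ q (ℤ.-[1+ m ]) v = realisable-cong (λ u → ℤ.neg-distribˡ-* (+ suc m) (δ v u))
    (realisable-neg {λ u → + suc m * δ v u} (realisable-ℕ-scaled-δ q (suc m) v))

  realisable-∑ : Vertex F → ∀ {m} (g : Fin m → Vertex F → ℤ) → (∀ i → Realisable (g i)) →
                 Realisable (λ u → ∑[ i < m ] g i u)
  realisable-∑ q {zero}  g realise = realisable-zero q
  realisable-∑ q {suc m} g realise = realisable-+ {g Fin.zero} {λ u → ∑[ i < m ] g (Fin.suc i) u}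
    (realise Fin.zero) (realisable-∑ q (g ∘ Fin.suc) (realise ∘ Fin.suc))

  Δ⇒equiv : Vertex F → ∀ h → Realisable h
  Δ⇒equiv q h =
    realisable-cong h-as-sum (realisable-∑ q (λ v u → h v * δ v u) (λ v → realisable-scaled-δ q (h v) v))
    where
    h-as-sum : (λ u → ∑[ v < n ] (h v * δ v u)) ≗ h
    h-as-sum u = trans (sum-cong-≗ λ v → trans (ℤ.*-comm (h v) (δ v u)) (cong (_* h v) (𝟙-≟-sym u v)))
                       (sum-δ h u)

module FirstRowDivisor (F : Ferrers) where

  open RookGraph F

  k ℓ c : ℕ
  k = rowSize F 1
  ℓ = rowSize F 2
  c = k ∸ ℓ

  D : Divisor F
  D = Dab F (k + 1) 1

  Upper : Pred (Vertex F) 0ℓ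
  Upper u = Y u ≢ 1

  upper? : Decidable Upper
  upper? u = ¬? (Y u ℕ.≟ 1)

  Left : Pred (Vertex F) 0ℓ
  Left u = X u ℕ.≤ ℓ

  left? : Decidable Left
  left? u = X u ℕ.≤? ℓ

  ℓ≤k : ℓ ℕ.≤ k
  ℓ≤k = rowSize-antitone F (s≤s z≤n)

  upper⇒1<Y : ∀ {u} → Upper u → 1 ℕ.< Y u
  upper⇒1<Y {u} Y≢1 = ℕ.≤∧≢⇒< (proj₂ (∈F-positive F (cell∈F u))) (Y≢1 ∘ sym)

  below : ∀ u {y} → 1 ℕ.≤ y → y ℕ.≤ Y u → (X u , y) ∈F F
  below u = ∈F-down F (cell∈F u)

  upper⇒left : ∀ {u} → Upper u → Left u
  upper⇒left {u} Y≢1 = ∈F⇒≤rowSize F (below u (s≤s z≤n) (upper⇒1<Y Y≢1))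

  D≡𝟙upper : ∀ u → D u ≡ 𝟙 (upper? u)
  D≡𝟙upper u with proj₁ (cell F u) ℕ.≟ k + 1 | proj₂ (cell F u) ℕ.≟ 1
  ... | yes _     | yes Y≡1 = sym (𝟙-no (upper? u) (λ Y≢1 → Y≢1 Y≡1))
  ... | no _      | yes Y≡1 = sym (𝟙-no (upper? u) (λ Y≢1 → Y≢1 Y≡1))
  ... | no _      | no Y≢1  = sym (𝟙-yes (upper? u) Y≢1)
  ... | yes X≡k+1 | no Y≢1  = contradiction (ℕ.≤-trans (upper⇒left Y≢1) ℓ≤k)
    (λ X≤k → ℕ.n≮n k (subst (ℕ._≤ k) (trans X≡k+1 (ℕ.+-comm k 1)) X≤k))

  deg-upper-row1 : ∀ {w} → Y w ≡ 1 → deg[ upper? ] w ≡ + (colSize F (X w) ∸ 1)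
  deg-upper-row1 {w} Yw≡1 = begin
    deg[ upper? ] w                      ≡⟨ count-cong (adjacent? F w ∩? upper?) (column? ∘ cell F) to from ⟩
    count (column? ∘ cell F)             ≡⟨ count-lookup column? (cells F) ⟩
    + length (filter column? (cells F))  ≡⟨ cong +_ (length-columnBeyond F (X w) 1) ⟩
    + (colSize F (X w) ∸ 1)              ∎
    where
    open ≡-Reasoning
    column? : Decidable (RowBeyond (X w) 1 ∘ swap)
    column? = rowBeyond? (X w) 1 ∘ swap
    to : ∀ {u} → Adjacent F w u × Upper u → X u ≡ X w × 1 ℕ.< Y u
    to ((_ , inj₁ Xw≡Xu) , Yu≢1) = sym Xw≡Xu , upper⇒1<Y Yu≢1
    to ((_ , inj₂ Yw≡Yu) , Yu≢1) = contradiction (trans (sym Yw≡Yu) Yw≡1) Yu≢1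
    from : ∀ {u} → X u ≡ X w × 1 ℕ.< Y u → Adjacent F w u × Upper u
    from (Xu≡Xw , 1<Yu) = ((λ { refl → ℕ.<-irrefl (sym Yw≡1) 1<Yu }) , inj₁ (sym Xu≡Xw)) , ℕ.>⇒≢ 1<Yu

  deg-row1-upper : ∀ {w} → Upper w → deg[ ∁? upper? ] w ≡ + 1
  deg-row1-upper {w} Yw≢1 = trans (count-cong (adjacent? F w ∩? ∁? upper?) (Fin._≟ v) to from) (count-≡ v)
    where
    v : Vertex F
    v = proj₁ (vertexAt (below w (s≤s z≤n) (proj₂ (∈F-positive F (cell∈F w)))))
    v-cell : cell F v ≡ (X w , 1)
    v-cell = proj₂ (vertexAt (below w (s≤s z≤n) (proj₂ (∈F-positive F (cell∈F w)))))
    to : ∀ {u} → Adjacent F w u × ¬ Upper u → u ≡ v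
    to {u} ((_ , inj₁ Xw≡Xu) , ¬Yu≢1) =
      cell-injective (trans (cong₂ _,_ (sym Xw≡Xu) (decidable-stable (Y u ℕ.≟ 1) ¬Yu≢1)) (sym v-cell))
    to {u} ((_ , inj₂ Yw≡Yu) , ¬Yu≢1) = contradiction (λ Yu≡1 → Yw≢1 (trans Yw≡Yu Yu≡1)) ¬Yu≢1
    from : ∀ {u} → u ≡ v → Adjacent F w u × ¬ Upper u
    from refl = ((λ w≡v → Yw≢1 (trans (cong Y w≡v) (cong proj₂ v-cell))) , inj₁ (sym (cong proj₁ v-cell)))
              , λ Yv≢1 → Yv≢1 (cong proj₂ v-cell)

  deg-right-row1 : ∀ {w} → Y w ≡ 1 → Left w → deg[ ∁? left? ] w ≡ + c
  deg-right-row1 {w} Yw≡1 Xw≤ℓ = begin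
    deg[ ∁? left? ] w                             ≡⟨ count-cong (adjacent? F w ∩? ∁? left?) right? to from ⟩
    count right?                                  ≡⟨ count-lookup (rowBeyond? 1 ℓ) (cells F) ⟩
    + length (filter (rowBeyond? 1 ℓ) (cells F))  ≡⟨ cong +_ (length-rowBeyond F 1 ℓ) ⟩
    + c                                           ∎
    where
    open ≡-Reasoning
    right? : Decidable (RowBeyond 1 ℓ ∘ cell F)
    right? = rowBeyond? 1 ℓ ∘ cell F
    to : ∀ {u} → Adjacent F w u × ¬ Left u → Y u ≡ 1 × ℓ ℕ.< X u
    to ((_ , inj₁ Xw≡Xu) , Xu≰ℓ) = contradiction (subst (ℕ._≤ ℓ) Xw≡Xu Xw≤ℓ) Xu≰ℓ
    to ((_ , inj₂ Yw≡Yu) , Xu≰ℓ) = trans (sym Yw≡Yu) Yw≡1 , ℕ.≰⇒> Xu≰ℓ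
    from : ∀ {u} → Y u ≡ 1 × ℓ ℕ.< X u → Adjacent F w u × ¬ Left u
    from (Yu≡1 , ℓ<Xu) = ((λ { refl → ℕ.<⇒≱ ℓ<Xu Xw≤ℓ }) , inj₂ (trans Yw≡1 (sym Yu≡1))) , ℕ.<⇒≱ ℓ<Xu

  deg-right-upper : ∀ {w} → Upper w → deg[ ∁? left? ] w ≡ + 0
  deg-right-upper {w} Yw≢1 = count-none (adjacent? F w ∩? ∁? left?) λ where
    u ((_ , inj₁ Xw≡Xu) , Xu≰ℓ) → Xu≰ℓ (subst (ℕ._≤ ℓ) Xw≡Xu (upper⇒left Yw≢1))
    u ((_ , inj₂ Yw≡Yu) , Xu≰ℓ) → Xu≰ℓ (upper⇒left (λ Yu≡1 → Yw≢1 (trans Yw≡Yu Yu≡1)))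

  D-effective : Effective F D
  D-effective u = subst (+ 0 ≤_) (sym (D≡𝟙upper u)) (𝟙-nonneg (upper? u))

  D₁ : Divisor F
  D₁ w = D w - Δ (𝟙 ∘ upper?) w

  D~D₁ : Vertex F → Equiv F D D₁
  D~D₁ q = Δ⇒equiv q (𝟙 ∘ upper?) (λ _ → refl)

  D₁-upper : ∀ {w} → Upper w → D₁ w ≡ + 0
  D₁-upper {w} Yw≢1 = cong₂ _-_ (trans (D≡𝟙upper w) (𝟙-yes (upper? w) Yw≢1))
                                (trans (Δ-𝟙-∈ upper? Yw≢1) (deg-row1-upper Yw≢1))

  D₁-row1 : ∀ {w} → Y w ≡ 1 → D₁ w ≡ deg[ upper? ] w
  D₁-row1 {w} Yw≡1 = begin
    D w - Δ (𝟙 ∘ upper?) w       ≡⟨ cong₂ _-_ (trans (D≡𝟙upper w) (𝟙-no (upper? w) (λ Yw≢1 → Yw≢1 Yw≡1)))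
                                              (Δ-𝟙-∉ upper? (λ Yw≢1 → Yw≢1 Yw≡1)) ⟩
    + 0 - - deg[ upper? ] w      ≡⟨ trans (ℤ.+-identityˡ _) (ℤ.neg-involutive _) ⟩
    deg[ upper? ] w              ∎
    where open ≡-Reasoning

  D₁-effective : Effective F D₁
  D₁-effective w = by-row (Y w ℕ.≟ 1)
    where
    by-row : Dec (Y w ≡ 1) → + 0 ≤ D₁ w
    by-row (yes Yw≡1) = subst (+ 0 ≤_) (sym (trans (D₁-row1 Yw≡1) (deg-upper-row1 Yw≡1))) (+≤+ z≤n)
    by-row (no Yw≢1)  = ℤ.≤-reflexive (sym (D₁-upper Yw≢1))

  D₁-positive : ∀ {v} → Y v ≡ 1 → Left v → + 0 < D₁ v
  D₁-positive {v} Yv≡1 Xv≤ℓ = subst (+ 0 <_) (sym (trans (D₁-row1 Yv≡1) (deg-upper-row1 Yv≡1)))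
    (+<+ (ℕ.m+n≤o⇒m≤o∸n 1 (∈F⇒≤colSize F (≤rowSize⇒∈F F (proj₁ (∈F-positive F (cell∈F v))) Xv≤ℓ))))

  D₂ : Divisor F
  D₂ w = D₁ w - Δ (𝟙 ∘ left?) w

  D~D₂ : Vertex F → Equiv F D D₂
  D~D₂ q = Δ⇒equiv q (λ u → 𝟙 (upper? u) ℤ.+ 𝟙 (left? u)) λ w → begin
    D w - Δ (𝟙 ∘ upper?) w - Δ (𝟙 ∘ left?) w        ≡⟨ regroup (D w) (Δ (𝟙 ∘ upper?) w) (Δ (𝟙 ∘ left?) w) ⟩
    D w - (Δ (𝟙 ∘ upper?) w ℤ.+ Δ (𝟙 ∘ left?) w)    ≡⟨ cong (λ z → D w - z) (sym (Δ-+ (𝟙 ∘ upper?) (𝟙 ∘ left?) w)) ⟩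
    D w - Δ (λ u → 𝟙 (upper? u) ℤ.+ 𝟙 (left? u)) w  ∎
    where
    open ≡-Reasoning
    regroup : ∀ d a b → d - a - b ≡ d - (a ℤ.+ b)
    regroup = solve-∀

  D₂-upper : ∀ {w} → Upper w → D₂ w ≡ + 0
  D₂-upper {w} Yw≢1 =
    cong₂ _-_ (D₁-upper Yw≢1) (trans (Δ-𝟙-∈ left? (upper⇒left Yw≢1)) (deg-right-upper Yw≢1))

  D₂-row1-left : ∀ {w} → Y w ≡ 1 → Left w → D₂ w ≡ + (colSize F (X w) ∸ 1) - + c
  D₂-row1-left {w} Yw≡1 Xw≤ℓ = cong₂ _-_ (trans (D₁-row1 Yw≡1) (deg-upper-row1 Yw≡1))
                                         (trans (Δ-𝟙-∈ left? Xw≤ℓ) (deg-right-row1 Yw≡1 Xw≤ℓ))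

  D₂-right : ∀ {w} → ¬ Left w → D₂ w ≡ D₁ w ℤ.+ deg[ left? ] w
  D₂-right {w} Xw≰ℓ =
    trans (cong (λ z → D₁ w - z) (Δ-𝟙-∉ left? Xw≰ℓ)) (cong (λ z → D₁ w ℤ.+ z) (ℤ.neg-involutive _))

  module _ (corner∈F : (ℓ , c + 1) ∈F F) where

    D₂-effective : Effective F D₂
    D₂-effective w = by-position (Y w ℕ.≟ 1) (left? w)
      where
      by-position : Dec (Y w ≡ 1) → Dec (Left w) → + 0 ≤ D₂ w
      by-position (no Yw≢1)  _           = ℤ.≤-reflexive (sym (D₂-upper Yw≢1))
      by-position (yes Yw≡1) (yes Xw≤ℓ) =
        subst (+ 0 ≤_) (sym (D₂-row1-left Yw≡1 Xw≤ℓ)) (ℤ.i≤j⇒0≤j-i (+≤+ c≤height))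
        where
        c≤height : c ℕ.≤ colSize F (X w) ∸ 1
        c≤height = ℕ.m+n≤o⇒m≤o∸n c
          (∈F⇒≤colSize F (∈F-left F corner∈F (proj₁ (∈F-positive F (cell∈F w))) Xw≤ℓ))
      by-position (yes _)    (no Xw≰ℓ)  = subst (+ 0 ≤_) (sym (D₂-right Xw≰ℓ))
        (ℤ.+-mono-≤ (D₁-effective w) (count-nonneg (adjacent? F w ∩? left?)))

    D₂-positive : ∀ {v} → Y v ≡ 1 → ¬ Left v → + 0 < D₂ v
    D₂-positive {v} Yv≡1 Xv≰ℓ = subst (+ 0 <_) (sym (D₂-right Xv≰ℓ))
      (ℤ.+-mono-≤-< (D₁-effective v) (count-positive (adjacent? F v ∩? left?) (v∼origin , Xorigin≤ℓ)))
      where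
      o : Vertex F
      o = proj₁ (vertexAt (origin∈F F corner∈F))
      o-cell : cell F o ≡ (1 , 1)
      o-cell = proj₂ (vertexAt (origin∈F F corner∈F))
      Xorigin≤ℓ : Left o
      Xorigin≤ℓ = subst (ℕ._≤ ℓ) (sym (cong proj₁ o-cell)) (proj₁ (∈F-positive F corner∈F))
      v∼origin : Adjacent F v o
      v∼origin = (λ v≡o → Xv≰ℓ (subst Left (sym v≡o) Xorigin≤ℓ)) , inj₂ (trans Yv≡1 (sym (cong proj₂ o-cell)))

    positiveRank : PositiveRank F D
    positiveRank v = witness (Y v ℕ.≟ 1) (left? v)
      where
      witness : Dec (Y v ≡ 1) → Dec (Left v) → ∃ λ E → Effective F E × Equiv F D E × + 0 < E v
      witness (no Yv≢1)  _          = D , D-effective , ε ,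
        subst (+ 0 <_) (sym (trans (D≡𝟙upper v) (𝟙-yes (upper? v) Yv≢1))) (+<+ (s≤s z≤n))
      witness (yes Yv≡1) (yes Xv≤ℓ) = D₁ , D₁-effective , D~D₁ v , D₁-positive Yv≡1 Xv≤ℓ
      witness (yes Yv≡1) (no Xv≰ℓ)  = D₂ , D₂-effective , D~D₂ v , D₂-positive Yv≡1 Xv≰ℓ

  module _ (corner∉F : ¬ (ℓ , c + 1) ∈F F) (1≤k : 1 ℕ.≤ k) where

    ℓ<k : ℓ ℕ.< k
    ℓ<k = ℕ.≰⇒> λ k≤ℓ → corner∉F (subst₂ (λ x y → (x , y) ∈F F) (ℕ.≤-antisym k≤ℓ ℓ≤k)
      (cong (_+ 1) (sym (ℕ.m≤n⇒m∸n≡0 k≤ℓ))) (≤rowSize⇒∈F F 1≤k ℕ.≤-refl))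

    corner-height<c : colSize F ℓ ∸ 1 ℕ.< c
    corner-height<c = ℕ.≤-<-trans (ℕ.∸-monoˡ-≤ 1 height≤c) (ℕ.∸-monoʳ-< (s≤s z≤n) (ℕ.m<n⇒0<n∸m ℓ<k))
      where
      height≤c : colSize F ℓ ℕ.≤ c
      height≤c = ℕ.≮⇒≥ λ c<height → corner∉F
        (≤colSize⇒∈F F (ℕ.m≤n+m 1 c) (subst (ℕ._≤ colSize F ℓ) (ℕ.+-comm 1 c) c<height))

    q : Vertex F
    q = proj₁ (vertexAt (≤rowSize⇒∈F F 1≤k ℕ.≤-refl))

    q-cell : cell F q ≡ (k , 1)
    q-cell = proj₂ (vertexAt (≤rowSize⇒∈F F 1≤k ℕ.≤-refl))

    D₁q≡0 : D₁ q ≡ + 0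
    D₁q≡0 = trans (trans (D₁-row1 (cong proj₂ q-cell)) (deg-upper-row1 (cong proj₂ q-cell)))
                  (cong +_ (ℕ.m≤n⇒m∸n≡0 height≤1))
      where
      height≤1 : colSize F (X q) ℕ.≤ 1
      height≤1 = ℕ.≮⇒≥ λ 1<height → ℕ.<⇒≱ ℓ<k
        (subst (ℕ._≤ ℓ) (cong proj₁ q-cell) (∈F⇒≤rowSize F (≤colSize⇒∈F F (s≤s z≤n) 1<height)))

    -- An upper vertex of S has no chip to spare, so its whole row and column lie in S; this
    -- reaches the corner (ℓ , 1), which cannot pay its c neighbours right of column ℓ.
    module Burning {S : Pred (Vertex F) 0ℓ} (S? : Decidable S) (q∉S : ¬ S q) (S-fires : CanFire S? D₁) where

      upper-spreads : ∀ {w u} → S w → Upper w → X w ≡ X u ⊎ Y w ≡ Y u → S u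
      upper-spreads {w} {u} w∈S Yw≢1 shared = by-identity (w Fin.≟ u)
        where
        by-identity : Dec (w ≡ u) → S u
        by-identity (yes refl) = w∈S
        by-identity (no w≢u)   = decidable-stable (S? u) λ u∉S → ℤ.<⇒≱
          (count-positive (adjacent? F w ∩? ∁? S?) ((w≢u , shared) , u∉S))
          (ℤ.≤-trans (S-fires w∈S) (ℤ.≤-reflexive (D₁-upper Yw≢1)))

      upper-neighbour∈S : ∀ {w} → S w → Y w ≡ 1 → ¬ (∀ {u} → Adjacent F w u → Upper u → ¬ S u)
      upper-neighbour∈S {w} w∈S Yw≡1 none = ℤ.<-irrefl refl (begin-strict
        deg[ upper? ] w  <⟨ count-mono-< (adjacent? F w ∩? upper?) (adjacent? F w ∩? ∁? S?)
                              (λ (w∼u , Yu≢1) → w∼u , none w∼u Yu≢1)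
                              (w∼q , q∉S) (λ (_ , Yq≢1) → Yq≢1 Yq≡1) ⟩
        deg[ ∁? S? ] w   ≤⟨ S-fires w∈S ⟩
        D₁ w             ≡⟨ D₁-row1 Yw≡1 ⟩
        deg[ upper? ] w  ∎)
        where
        open ℤ.≤-Reasoning
        Yq≡1 : Y q ≡ 1
        Yq≡1 = cong proj₂ q-cell
        w∼q : Adjacent F w q
        w∼q = (λ w≡q → q∉S (subst S w≡q w∈S)) , inj₂ (trans Yw≡1 (sym Yq≡1))

      row1∈S⇒left : ∀ {w} → S w → Y w ≡ 1 → Left w
      row1∈S⇒left {w} w∈S Yw≡1 = decidable-stable (left? w) λ Xw≰ℓ → upper-neighbour∈S w∈S Yw≡1 λ where
        (_ , inj₁ Xw≡Xu) Yu≢1 _ → Xw≰ℓ (subst (ℕ._≤ ℓ) (sym Xw≡Xu) (upper⇒left Yu≢1))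
        (_ , inj₂ Yw≡Yu) Yu≢1 _ → Yu≢1 (trans (sym Yw≡Yu) Yw≡1)

      corner∉S : ∀ {p} → cell F p ≡ (ℓ , 1) → ¬ S p
      corner∉S {p} p-cell p∈S = ℤ.<-irrefl refl (begin-strict
        + c                     ≡⟨ sym (deg-right-row1 Yp≡1 Xp≤ℓ) ⟩
        deg[ ∁? left? ] p       ≤⟨ count-mono (adjacent? F p ∩? ∁? left?) (adjacent? F p ∩? ∁? S?) right⇒∉S ⟩
        deg[ ∁? S? ] p          ≤⟨ S-fires p∈S ⟩
        D₁ p                    ≡⟨ trans (D₁-row1 Yp≡1) (deg-upper-row1 Yp≡1) ⟩
        + (colSize F (X p) ∸ 1) <⟨ +<+ (subst (λ x → colSize F x ∸ 1 ℕ.< c) (sym Xp≡ℓ) corner-height<c) ⟩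
        + c                     ∎)
        where
        open ℤ.≤-Reasoning
        Yp≡1 : Y p ≡ 1
        Yp≡1 = cong proj₂ p-cell
        Xp≡ℓ : X p ≡ ℓ
        Xp≡ℓ = cong proj₁ p-cell
        Xp≤ℓ : Left p
        Xp≤ℓ = ℕ.≤-reflexive Xp≡ℓ
        right⇒∉S : ∀ {u} → Adjacent F p u × ¬ Left u → Adjacent F p u × ¬ S u
        right⇒∉S ((_ , inj₁ Xp≡Xu) , Xu≰ℓ) = contradiction (subst (ℕ._≤ ℓ) Xp≡Xu Xp≤ℓ) Xu≰ℓ
        right⇒∉S (p∼u@(_ , inj₂ Yp≡Yu) , Xu≰ℓ) =
          p∼u , λ u∈S → Xu≰ℓ (row1∈S⇒left u∈S (trans (sym Yp≡Yu) Yp≡1))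

      spread-to : ∀ {w x y} → S w → Upper w → (x , y) ∈F F → X w ≡ x ⊎ Y w ≡ y →
                  ∃ λ u → cell F u ≡ (x , y) × S u
      spread-to w∈S Yw≢1 p shared with u , u-cell ← vertexAt p =
        u , u-cell , upper-spreads w∈S Yw≢1
          (Sum.map (λ e → trans e (sym (cong proj₁ u-cell))) (λ e → trans e (sym (cong proj₂ u-cell))) shared)

      upper∉S : ∀ {u} → Upper u → ¬ S u
      upper∉S {u} Yu≢1 u∈S =
        let a , a-cell , a∈S = spread-to u∈S Yu≢1 (below u (s≤s z≤n) (upper⇒1<Y Yu≢1)) (inj₁ refl)
            b , b-cell , b∈S = spread-to a∈S (in-row2 a-cell) ℓ2∈F (inj₂ (cong proj₂ a-cell))
            p , p-cell , p∈S = spread-to b∈S (in-row2 b-cell) (∈F-down F ℓ2∈F (s≤s z≤n) (s≤s z≤n))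
                                         (inj₁ (cong proj₁ b-cell))
        in corner∉S p-cell p∈S
        where
        ℓ2∈F : (ℓ , 2) ∈F F
        ℓ2∈F = ≤rowSize⇒∈F F (ℕ.≤-trans (proj₁ (∈F-positive F (cell∈F u))) (upper⇒left Yu≢1)) ℕ.≤-refl
        in-row2 : ∀ {v x} → cell F v ≡ (x , 2) → Upper v
        in-row2 v-cell Yv≡1 = contradiction (trans (sym (cong proj₂ v-cell)) Yv≡1) λ ()

      S-empty : ∀ w → ¬ S w
      S-empty w w∈S = by-row (Y w ℕ.≟ 1)
        where
        by-row : Dec (Y w ≡ 1) → ⊥
        by-row (yes Yw≡1) = upper-neighbour∈S w∈S Yw≡1 (λ _ Yu≢1 → upper∉S Yu≢1)
        by-row (no Yw≢1)  = upper∉S Yw≢1 w∈S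

    D₁-reduced : Reduced D₁ q
    D₁-reduced S? q∉S S-fires = Burning.S-empty S? q∉S S-fires

    notPositiveRank : ¬ PositiveRank F D
    notPositiveRank positive with E , E≥0 , D~E , 0<Eq ← positive q
      with h , E≡ ← equiv⇒Δ (EqClosure.transitive _ (EqClosure.symmetric _ (D~D₁ q)) D~E) =
      ℤ.<⇒≱ 0<Eq (reduced⇒nonpositive {h = h} D₁-reduced (ℤ.≤-reflexive D₁q≡0) E≥0 E≡)

proposition3p2 : (F : Ferrers) → cells F ≢ [] →
    PositiveRank F (Dab F (rowSize F 1 + 1) 1)
      ⇔ ((rowSize F 2 , rowSize F 1 ∸ rowSize F 2 + 1) ∈F F)
proposition3p2 F cells≢[] = mk⇔
  (λ positive → decidable-stable (DecMembership._∈?_ _≟ᶜ_ (ℓ , c + 1) (cells F))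
                                  (λ corner∉F → notPositiveRank corner∉F 1≤k positive))
  positiveRank
  where
  open FirstRowDivisor F
  1≤k : 1 ℕ.≤ k
  1≤k = ∈F⇒≤rowSize F (origin∈F F (proj₂ (nonempty-member cells≢[])))
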